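{- For every positive integer $n$, the vertices of the harmonic polytope $H_{n,n}$ are the points \[ v_\tau=\mathsf{e}_k+\mathsf{f}_k+(\pi_1^{ -1},0)+(0,\pi_2^{ -1}) \] as $\tau=(k;\pi_1,\pi_2)$ ranges over the fine harmonic triples on $[n]$.
   Context: Let $\mathsf{e}_i,\mathsf{f}_i$ ($i\in[n]$) be the standard bases of two copies of $\mathbb{R}^n$. $\Pi_n=\mathrm{conv}\{(x_1,\dots,x_n): x \text{ a permutation of } [n]\}\subset\mathbb{R}^n$, $D_n=\mathrm{conv}\{\mathsf{e}_i+\mathsf{f}_i: i\in[n]\}$, and $H_{n,n}=D_n+(\Pi_n\times\Pi_n)\subset\mathbb{R}^n\times\mathbb{R}^n$. A fine harmonic triple $(k;\pi_1,\pi_2)$ consists of an element $k\in[n]$ and two permutations $\pi_1,\pi_2$ of $[n]$, written in one-line notation $\pi=\pi(1)\pi(2)\cdots\pi(n)$, such that whenever $j\neq k$ appears after $k$ in one of $\pi_1,\pi_2$, then $j$ appears before $k$ in the other. For a permutation $\pi$, $\pi^{ -1}$ denotes the vector in $\mathbb{R}^n$ whose $i$-th coordinate is the position of $i$ in the one-line notation of $\pi$ (the inverse permutation in one-line notation).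
   Formalization: Points of $\mathbb{R}^n\times\mathbb{R}^n$ have rational rather than real coordinates, and the weights of convex combinations, both in the convex hulls and in the definition of a vertex, are rational. -}

module Defs where

open import Data.Nat using (ℕ; suc)
open import Data.Fin using (Fin; toℕ)
import Data.Fin as F
open import Data.Fin.Permutation using (Permutation′; _⟨$⟩ʳ_; _⟨$⟩ˡ_)
open import Data.Rational using (ℚ; 0ℚ; 1ℚ; _+_; _*_; _-_; _≤_; _<_)
open import Data.Integer using (+_)
import Data.Rational as Q
open import Data.List using (List; []; _∷_; map)
open import Data.List.Relation.Unary.All using (All)
open import Data.Product using (_×_; _,_; Σ; ∃; proj₁; proj₂)
open import Relation.Binary.PropositionalEquality using (_≡_; _≢_)
open import Relation.Nullary using (Dec; yes; no)

ℕtoℚ : ℕ → ℚ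
ℕtoℚ m = (+ m) Q./ 1

-- points of ℝⁿ × ℝⁿ, with rational coordinates
Pt : ℕ → Set
Pt n = (Fin n → ℚ) × (Fin n → ℚ)

_≈_ : ∀ {n} → Pt n → Pt n → Set
_≈_ {n} (x , y) (x' , y') = (∀ i → x i ≡ x' i) × (∀ i → y i ≡ y' i)

_⊕_ : ∀ {n} → Pt n → Pt n → Pt n
(x , y) ⊕ (x' , y') = (λ i → x i + x' i) , (λ i → y i + y' i)

_·_ : ∀ {n} → ℚ → Pt n → Pt n
c · (x , y) = (λ i → c * x i) , (λ i → c * y i)

origin : ∀ {n} → Pt n
origin = (λ _ → 0ℚ) , (λ _ → 0ℚ)

PSet : ℕ → Set₁
PSet n = Pt n → Set

wsum : ∀ {n} → List (ℚ × Pt n) → Pt n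
wsum [] = origin
wsum ((c , p) ∷ l) = (c · p) ⊕ wsum l

wtotal : ∀ {n} → List (ℚ × Pt n) → ℚ
wtotal [] = 0ℚ
wtotal ((c , _) ∷ l) = c + wtotal l

conv : ∀ {n} → PSet n → PSet n
conv S x = Σ (List (ℚ × Pt _)) λ l →
  All (λ cp → (0ℚ ≤ proj₁ cp) × S (proj₂ cp)) l × (wtotal l ≡ 1ℚ) × (x ≈ wsum l)

_+ₘ_ : ∀ {n} → PSet n → PSet n → PSet n
(A +ₘ B) x = Σ _ λ a → Σ _ λ b → A a × B b × (x ≈ (a ⊕ b))

-- one-line vector of a permutation: i ↦ π(i) ∈ [n]  (values 1..n)
oneLine : ∀ {n} → Permutation′ n → Fin n → ℚ
oneLine π i = ℕtoℚ (suc (toℕ (π ⟨$⟩ʳ i)))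

-- π⁻¹ as a vector: i ↦ position of i in the one-line notation of π (1..n)
invVec : ∀ {n} → Permutation′ n → Fin n → ℚ
invVec π i = ℕtoℚ (suc (toℕ (π ⟨$⟩ˡ i)))

-- position (0-based) of j in one-line notation of π
pos : ∀ {n} → Permutation′ n → Fin n → ℕ
pos π j = toℕ (π ⟨$⟩ˡ j)

PermVerts : (n : ℕ) → (Fin n → ℚ) → Set
PermVerts n x = Σ (Permutation′ n) λ π → ∀ i → x i ≡ oneLine π i

PiPi : (n : ℕ) → PSet n
PiPi n = conv (λ p → PermVerts n (proj₁ p) × PermVerts n (proj₂ p))

δ : ∀ {n} → Fin n → Fin n → ℚ
δ i j with i F.≟ j
... | yes _ = 1ℚ
... | no _ = 0ℚ

ef : ∀ {n} → Fin n → Pt n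
ef i = δ i , δ i

D : (n : ℕ) → PSet n
D n = conv (λ p → Σ (Fin n) λ i → p ≈ ef i)

H : (n : ℕ) → PSet n
H n = D n +ₘ PiPi n

IsVertex : ∀ {n} → PSet n → Pt n → Set
IsVertex P v = P v × (∀ x y (t : ℚ) → P x → P y → 0ℚ < t → t < 1ℚ →
                 v ≈ ((t · x) ⊕ ((1ℚ - t) · y)) → (x ≈ v) × (y ≈ v))

_<ℕ_ : ℕ → ℕ → Set
_<ℕ_ = Data.Nat._<_
  where import Data.Nat

FineHarmonic : (n : ℕ) → Fin n → Permutation′ n → Permutation′ n → Set
FineHarmonic n k π₁ π₂ = ∀ j → j ≢ k →
  (pos π₁ k <ℕ pos π₁ j → pos π₂ j <ℕ pos π₂ k) ×
  (pos π₂ k <ℕ pos π₂ j → pos π₁ j <ℕ pos π₁ k)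

vτ : ∀ {n} → Fin n → Permutation′ n → Permutation′ n → Pt n
vτ k π₁ π₂ = ef k ⊕ (invVec π₁ , invVec π₂)

module Submission where

-- A vertex of the Minkowski sum H = Dₙ + (Πₙ × Πₙ) is eₖ + fₖ + (σ, ρ) for a vertex eₖ + fₖ of Dₙ and
-- permutation vectors σ, ρ.  If σₖ < σⱼ and ρₖ < ρⱼ for some j ≠ k, let σ′ and ρ′ swap the entries k and
-- j; a convex combination of (σ, ρ), (σ′, ρ) and (σ, ρ′) is (σ, ρ) + ½ (eₖ − eⱼ, fₖ − fⱼ), which makes
-- eₖ + fₖ + (σ, ρ) = ⅓ (eⱼ + fⱼ + (σ, ρ)) + ⅔ (eₖ + fₖ + (σ, ρ) + ½ (eₖ − eⱼ, fₖ − fⱼ)) an interior point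
-- of a segment in H.  Ruling this out for every j ≠ k says exactly that (k; σ⁻¹, ρ⁻¹) is fine harmonic.
--
-- Conversely, for a fine harmonic triple (k; π₁, π₂) give coordinate j of the i-th factor the weight
-- pos_πᵢ(j), raised by 2n when j does not come before k in πᵢ.  By the rearrangement inequality the
-- resulting linear functional is maximal on Πₙ × Πₙ only at (π₁⁻¹, π₂⁻¹); since no j ≠ k comes after k
-- in both π₁ and π₂, only k is raised twice, so on Dₙ it is maximal only at eₖ + fₖ.  Hence on H it is
-- maximal only at v_τ, which is therefore a vertex.

open import Defs

module FiniteSums where

  import Data.Nat.Properties as ℕ
  import Data.Rational.Properties as ℚ
  open import Algebra.Bundles using (CommutativeRing)
  import Algebra.Properties.Semiring.Sum as SemiringSum

  module ℚΣ = SemiringSum (CommutativeRing.semiring ℚ.+-*-commutativeRing)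
  module ℕΣ = SemiringSum ℕ.+-*-semiring

module NatEmbedding where

  open import Data.Nat as ℕ using (ℕ; zero; suc)
  open import Data.Nat.Coprimality using (1-coprimeTo; sym)
  open import Data.Fin as Fin using (Fin)
  import Data.Integer as ℤ
  import Data.Integer.Properties as ℤ
  open import Data.Rational using (mkℚ; _+_; _*_; _≤_; _<_; *≤*; *<*; ↥_)
  import Data.Rational.Properties as ℚ
  open import Function using (_∘_)
  open import Relation.Binary.PropositionalEquality
    using (_≡_; refl; cong; cong₂; subst₂; trans) renaming (sym to ≡-sym)
  open FiniteSums

  ℕtoℚ≡mkℚ : ∀ m → ℕtoℚ m ≡ mkℚ (ℤ.+ m) 0 (sym (1-coprimeTo m))
  ℕtoℚ≡mkℚ m = ℚ.normalize-coprime (sym (1-coprimeTo m))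

  ℕtoℚ-homo-+ : ∀ a b → ℕtoℚ (a ℕ.+ b) ≡ ℕtoℚ a + ℕtoℚ b
  ℕtoℚ-homo-+ a b rewrite ℕtoℚ≡mkℚ a | ℕtoℚ≡mkℚ b =
    ℚ./-cong (cong₂ ℤ._+_ (≡-sym (ℤ.*-identityʳ (ℤ.+ a))) (≡-sym (ℤ.*-identityʳ (ℤ.+ b)))) refl

  ℕtoℚ-homo-* : ∀ a b → ℕtoℚ (a ℕ.* b) ≡ ℕtoℚ a * ℕtoℚ b
  ℕtoℚ-homo-* a b rewrite ℕtoℚ≡mkℚ a | ℕtoℚ≡mkℚ b = ℚ./-cong (ℤ.pos-* a b) refl

  ℕtoℚ-mono-≤ : ∀ {a b} → a ℕ.≤ b → ℕtoℚ a ≤ ℕtoℚ b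
  ℕtoℚ-mono-≤ {a} {b} a≤b rewrite ℕtoℚ≡mkℚ a | ℕtoℚ≡mkℚ b =
    *≤* (subst₂ ℤ._≤_ (≡-sym (ℤ.*-identityʳ (ℤ.+ a))) (≡-sym (ℤ.*-identityʳ (ℤ.+ b))) (ℤ.+≤+ a≤b))

  ℕtoℚ-mono-< : ∀ {a b} → a ℕ.< b → ℕtoℚ a < ℕtoℚ b
  ℕtoℚ-mono-< {a} {b} a<b rewrite ℕtoℚ≡mkℚ a | ℕtoℚ≡mkℚ b =
    *<* (subst₂ ℤ._<_ (≡-sym (ℤ.*-identityʳ (ℤ.+ a))) (≡-sym (ℤ.*-identityʳ (ℤ.+ b))) (ℤ.+<+ a<b))

  ℕtoℚ-injective : ∀ {a b} → ℕtoℚ a ≡ ℕtoℚ b → a ≡ b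
  ℕtoℚ-injective {a} {b} eq rewrite ℕtoℚ≡mkℚ a | ℕtoℚ≡mkℚ b = ℤ.+-injective (cong ↥_ eq)

  ℕtoℚ-sum : ∀ {n} (f : Fin n → ℕ) → ℚΣ.sum (ℕtoℚ ∘ f) ≡ ℕtoℚ (ℕΣ.sum f)
  ℕtoℚ-sum {zero} f = refl
  ℕtoℚ-sum {suc n} f = trans (cong (ℕtoℚ (f Fin.zero) +_) (ℕtoℚ-sum (f ∘ Fin.suc)))
                             (≡-sym (ℕtoℚ-homo-+ (f Fin.zero) (ℕΣ.sum (f ∘ Fin.suc))))

module RationalOrder where

  open import Data.Rational using (ℚ; 0ℚ; 1ℚ; _+_; _*_; _-_; -_; _≤_; _<_; positive; nonNegative)
  import Data.Rational.Properties as ℚ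
  open import Data.Product using (_×_; _,_)
  open import Data.Sum using (inj₁; inj₂)
  open import Relation.Binary.PropositionalEquality

  +-tight-≤ : ∀ {a b c d} → a ≤ b → c ≤ d → a + c ≡ b + d → (a ≡ b) × (c ≡ d)
  +-tight-≤ a≤b c≤d eq =
    ℚ.≤-antisym a≤b (ℚ.≮⇒≥ (λ a<b → ℚ.<⇒≢ (ℚ.+-mono-<-≤ a<b c≤d) eq)) ,
    ℚ.≤-antisym c≤d (ℚ.≮⇒≥ (λ c<d → ℚ.<⇒≢ (ℚ.+-mono-≤-< a≤b c<d) eq))

  *-cancelˡ-≡-pos : ∀ {c a b} → 0ℚ < c → c * a ≡ c * b → a ≡ b
  *-cancelˡ-≡-pos {c} 0<c eq = ℚ.≤-antisym (cancel (ℚ.≤-reflexive eq)) (cancel (ℚ.≤-reflexive (sym eq)))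
    where
    cancel : ∀ {a b} → c * a ≤ c * b → a ≤ b
    cancel = ℚ.*-cancelˡ-≤-pos c {{positive 0<c}}

  *-monoˡ-≤-nonNeg′ : ∀ {c a b} → 0ℚ ≤ c → a ≤ b → c * a ≤ c * b
  *-monoˡ-≤-nonNeg′ {c} 0≤c = ℚ.*-monoˡ-≤-nonNeg c {{nonNegative 0≤c}}

  x<1⇒0<1-x : ∀ {x} → x < 1ℚ → 0ℚ < 1ℚ - x
  x<1⇒0<1-x {x} x<1 = subst (_< 1ℚ - x) (ℚ.+-inverseʳ x) (ℚ.+-monoˡ-< (- x) x<1)

  x≤1⇒0≤1-x : ∀ {x} → x ≤ 1ℚ → 0ℚ ≤ 1ℚ - x
  x≤1⇒0≤1-x {x} x≤1 = subst (_≤ 1ℚ - x) (ℚ.+-inverseʳ x) (ℚ.+-monoˡ-≤ (- x) x≤1)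

  +-≤-doubles : ∀ {μ ν} → μ + μ ≤ 1ℚ → ν + ν ≤ 1ℚ → μ + ν ≤ 1ℚ
  +-≤-doubles {μ} {ν} μ+μ≤1 ν+ν≤1 with ℚ.≤-total μ ν
  ... | inj₁ μ≤ν = ℚ.≤-trans (ℚ.+-monoˡ-≤ ν μ≤ν) ν+ν≤1
  ... | inj₂ ν≤μ = ℚ.≤-trans (ℚ.+-monoʳ-≤ μ ν≤μ) μ+μ≤1

module Points where

  open FiniteSums using (module ℚΣ)
  open ℚΣ using (sum; sum-cong-≗; ∑-distrib-+; *-distribˡ-sum)
  open import Data.Nat using (ℕ)
  open import Data.Fin using (Fin)
  open import Data.Rational using (ℚ; 0ℚ; 1ℚ; _+_; _*_; _≤_)
  import Data.Rational.Properties as ℚ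
  open import Data.Rational.Solver using (module +-*-Solver)
  open import Data.Product using (_×_; _,_)
  open import Algebra.Bundles using (CommutativeMonoid)
  open import Algebra.Properties.CommutativeSemigroup
    (CommutativeMonoid.commutativeSemigroup ℚ.+-0-commutativeMonoid) using (interchange)
  open import Relation.Binary.PropositionalEquality
  open +-*-Solver

  private variable
    n : ℕ
    p q r p′ q′ : Pt n

  ≈-refl : p ≈ p
  ≈-refl = (λ _ → refl) , (λ _ → refl)

  ≈-sym : p ≈ q → q ≈ p
  ≈-sym (e₁ , e₂) = (λ i → sym (e₁ i)) , (λ i → sym (e₂ i))

  ≈-trans : p ≈ q → q ≈ r → p ≈ r
  ≈-trans (e₁ , e₂) (f₁ , f₂) = (λ i → trans (e₁ i) (f₁ i)) , (λ i → trans (e₂ i) (f₂ i))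

  ⊕-cong : p ≈ q → p′ ≈ q′ → (p ⊕ p′) ≈ (q ⊕ q′)
  ⊕-cong (e₁ , e₂) (f₁ , f₂) = (λ i → cong₂ _+_ (e₁ i) (f₁ i)) , (λ i → cong₂ _+_ (e₂ i) (f₂ i))

  ⊕-congˡ : ∀ (p : Pt n) → q ≈ q′ → (p ⊕ q) ≈ (p ⊕ q′)
  ⊕-congˡ p = ⊕-cong (≈-refl {p = p})

  ⊕-congʳ : ∀ (p : Pt n) → q ≈ q′ → (q ⊕ p) ≈ (q′ ⊕ p)
  ⊕-congʳ p q≈q′ = ⊕-cong q≈q′ (≈-refl {p = p})

  ·-congˡ : ∀ c → p ≈ q → (c · p) ≈ (c · q)
  ·-congˡ c (e₁ , e₂) = (λ i → cong (c *_) (e₁ i)) , (λ i → cong (c *_) (e₂ i))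

  ⊕-comm : (p q : Pt n) → (p ⊕ q) ≈ (q ⊕ p)
  ⊕-comm (x , y) (x′ , y′) = (λ i → ℚ.+-comm (x i) (x′ i)) , (λ i → ℚ.+-comm (y i) (y′ i))

  ⊕-identityˡ : (p : Pt n) → (origin ⊕ p) ≈ p
  ⊕-identityˡ (x , y) = (λ i → ℚ.+-identityˡ (x i)) , (λ i → ℚ.+-identityˡ (y i))

  ⊕-identityʳ : (p : Pt n) → (p ⊕ origin) ≈ p
  ⊕-identityʳ (x , y) = (λ i → ℚ.+-identityʳ (x i)) , (λ i → ℚ.+-identityʳ (y i))

  ·-zeroˡ : (p : Pt n) → (0ℚ · p) ≈ origin
  ·-zeroˡ (x , y) = (λ i → ℚ.*-zeroˡ (x i)) , (λ i → ℚ.*-zeroˡ (y i))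

  ·-zeroʳ : ∀ c → (c · origin {n}) ≈ origin
  ·-zeroʳ c = (λ _ → ℚ.*-zeroʳ c) , (λ _ → ℚ.*-zeroʳ c)

  ·-identityˡ : (p : Pt n) → (1ℚ · p) ≈ p
  ·-identityˡ (x , y) = (λ i → ℚ.*-identityˡ (x i)) , (λ i → ℚ.*-identityˡ (y i))

  ·-assoc : ∀ c d (p : Pt n) → (c · (d · p)) ≈ ((c * d) · p)
  ·-assoc c d (x , y) = (λ i → sym (ℚ.*-assoc c d (x i))) , (λ i → sym (ℚ.*-assoc c d (y i)))

  ·-distribʳ-+ : ∀ c d (p : Pt n) → ((c · p) ⊕ (d · p)) ≈ ((c + d) · p)
  ·-distribʳ-+ c d (x , y) = (λ i → sym (ℚ.*-distribʳ-+ (x i) c d)) , (λ i → sym (ℚ.*-distribʳ-+ (y i) c d))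

  ·-distribˡ-⊕ : ∀ c (p q : Pt n) → (c · (p ⊕ q)) ≈ ((c · p) ⊕ (c · q))
  ·-distribˡ-⊕ c (x , y) (x′ , y′) =
    (λ i → ℚ.*-distribˡ-+ c (x i) (x′ i)) , (λ i → ℚ.*-distribˡ-+ c (y i) (y′ i))

  WeightedIn : PSet n → ℚ × Pt n → Set
  WeightedIn S (c , s) = (0ℚ ≤ c) × S s

  inner : (Fin n → ℚ) → (Fin n → ℚ) → ℚ
  inner w x = sum (λ i → w i * x i)

  inner-+ : ∀ (w x y : Fin n → ℚ) → inner w (λ i → x i + y i) ≡ inner w x + inner w y
  inner-+ {n} w x y =
    trans (sum-cong-≗ {n} (λ i → ℚ.*-distribˡ-+ (w i) (x i) (y i))) (∑-distrib-+ (λ i → w i * x i) (λ i → w i * y i))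

  inner-* : ∀ c (w x : Fin n → ℚ) → inner w (λ i → c * x i) ≡ c * inner w x
  inner-* {n} c w x = trans (sum-cong-≗ {n} (λ i → swap (w i) c (x i))) (sym (*-distribˡ-sum c (λ i → w i * x i)))
    where
    swap : ∀ a b d → a * (b * d) ≡ b * (a * d)
    swap = solve 3 (λ a b d → a :* (b :* d) := b :* (a :* d)) refl

  dot : Pt n → Pt n → ℚ
  dot (w₁ , w₂) (x , y) = inner w₁ x + inner w₂ y

  dot-cong : ∀ (W : Pt n) → p ≈ q → dot W p ≡ dot W q
  dot-cong (w₁ , w₂) (e₁ , e₂) =
    cong₂ _+_ (sum-cong-≗ (λ i → cong (w₁ i *_) (e₁ i))) (sum-cong-≗ (λ i → cong (w₂ i *_) (e₂ i)))

  dot-⊕ : ∀ (W p q : Pt n) → dot W (p ⊕ q) ≡ dot W p + dot W q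
  dot-⊕ (w₁ , w₂) (x , y) (x′ , y′) =
    trans (cong₂ _+_ (inner-+ w₁ x x′) (inner-+ w₂ y y′))
          (interchange (inner w₁ x) (inner w₁ x′) (inner w₂ y) (inner w₂ y′))

  dot-· : ∀ (W p : Pt n) c → dot W (c · p) ≡ c * dot W p
  dot-· (w₁ , w₂) (x , y) c =
    trans (cong₂ _+_ (inner-* c w₁ x) (inner-* c w₂ y)) (sym (ℚ.*-distribˡ-+ c (inner w₁ x) (inner w₂ y)))

  dot-origin : ∀ (W : Pt n) → dot W origin ≡ 0ℚ
  dot-origin W = trans (dot-cong W (≈-sym (·-zeroˡ origin))) (trans (dot-· W origin 0ℚ) (ℚ.*-zeroˡ (dot W origin)))

module Exposure where

  open Points
  open RationalOrder
  open import Data.Rational using (ℚ; 0ℚ; 1ℚ; _+_; _*_; _-_; _≤_; _<_)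
  import Data.Rational.Properties as ℚ
  open import Data.Rational.Solver using (module +-*-Solver)
  open import Data.Product using (_×_; _,_; proj₁; proj₂)
  open import Data.List using ([]; _∷_)
  open import Data.List.Relation.Unary.All using (All; []; _∷_)
  open import Relation.Binary.Definitions using (tri<; tri≈; tri>)
  open import Relation.Binary.PropositionalEquality
  open import Relation.Nullary using (contradiction)
  open +-*-Solver

  record Exposes {n} (W : Pt n) (M : ℚ) (P : PSet n) (v : Pt n) : Set where
    field
      bound : ∀ {x} → P x → dot W x ≤ M
      tight : ∀ {x} → P x → dot W x ≡ M → x ≈ v

  open Exposes

  module _ {n} {W : Pt n} {M : ℚ} {v : Pt n} where

    scaled-tight : ∀ {c s} → 0ℚ ≤ c → (dot W s ≡ M → s ≈ v) → c * dot W s ≡ c * M → (c · s) ≈ (c · v)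
    scaled-tight {c} {s} 0≤c tight eq with ℚ.<-cmp 0ℚ c
    ... | tri< 0<c _ _ = ·-congˡ c (tight (*-cancelˡ-≡-pos 0<c eq))
    ... | tri≈ _ refl _ = ≈-trans (·-zeroˡ s) (≈-sym (·-zeroˡ v))
    ... | tri> _ _ c<0 = contradiction (ℚ.<-≤-trans c<0 0≤c) (ℚ.<-irrefl refl)

    wsum-exposes : ∀ {S} → Exposes W M S v → ∀ L → All (WeightedIn S) L →
                   (dot W (wsum L) ≤ wtotal L * M) × (dot W (wsum L) ≡ wtotal L * M → wsum L ≈ (wtotal L · v))
    wsum-exposes exp [] [] =
      ℚ.≤-reflexive (trans (dot-origin W) (sym (ℚ.*-zeroˡ M))) , λ _ → ≈-sym (·-zeroˡ v)
    wsum-exposes exp ((c , s) ∷ L) ((0≤c , Ss) ∷ AL) =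
      subst₂ _≤_ (sym expand) (sym distrib) (ℚ.+-mono-≤ head≤ (proj₁ tail)) ,
      λ eq → let split = +-tight-≤ head≤ (proj₁ tail) (trans (sym expand) (trans eq distrib))
             in ≈-trans (⊕-cong (scaled-tight 0≤c (tight exp Ss) (proj₁ split)) (proj₂ tail (proj₂ split)))
                        (·-distribʳ-+ c (wtotal L) v)
      where
      tail = wsum-exposes exp L AL
      head≤ : c * dot W s ≤ c * M
      head≤ = *-monoˡ-≤-nonNeg′ 0≤c (bound exp Ss)
      expand : dot W ((c · s) ⊕ wsum L) ≡ c * dot W s + dot W (wsum L)
      expand = trans (dot-⊕ W (c · s) (wsum L)) (cong (_+ dot W (wsum L)) (dot-· W s c))
      distrib : (c + wtotal L) * M ≡ c * M + wtotal L * M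
      distrib = ℚ.*-distribʳ-+ M c (wtotal L)

    conv-exposes : ∀ {S} → Exposes W M S v → Exposes W M (conv S) v
    conv-exposes {S} exp = record
      { bound = λ { (L , AL , total≡1 , x≈) →
          subst₂ _≤_ (sym (dot-cong W x≈)) (scaled-M total≡1) (proj₁ (wsum-exposes exp L AL)) }
      ; tight = λ { (L , AL , total≡1 , x≈) eq →
          let dot-wsum≡ = trans (sym (dot-cong W x≈)) (trans eq (sym (scaled-M total≡1)))
          in ≈-trans x≈ (≈-trans (proj₂ (wsum-exposes exp L AL) dot-wsum≡)
                                 (subst (λ t → (t · v) ≈ v) (sym total≡1) (·-identityˡ v))) }
      }
      where
      scaled-M : ∀ {t} → t ≡ 1ℚ → t * M ≡ M
      scaled-M refl = ℚ.*-identityˡ M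

  +ₘ-exposes : ∀ {n} {W : Pt n} {M N A B a b} → Exposes W M A a → Exposes W N B b → Exposes W (M + N) (A +ₘ B) (a ⊕ b)
  +ₘ-exposes {W = W} expA expB = record
    { bound = λ { (y , z , Ay , Bz , x≈) → subst (_≤ _) (sym (dot-split x≈)) (ℚ.+-mono-≤ (bound expA Ay) (bound expB Bz)) }
    ; tight = λ { (y , z , Ay , Bz , x≈) eq →
        let split = +-tight-≤ (bound expA Ay) (bound expB Bz) (trans (sym (dot-split x≈)) eq)
        in ≈-trans x≈ (⊕-cong (tight expA Ay (proj₁ split)) (tight expB Bz (proj₂ split))) }
    }
    where
    dot-split : ∀ {x y z} → x ≈ (y ⊕ z) → dot W x ≡ dot W y + dot W z
    dot-split {x} {y} {z} x≈ = trans (dot-cong W x≈) (dot-⊕ W y z)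

  exposed⇒vertex : ∀ {n} {W : Pt n} {M P v} → P v → dot W v ≡ M → Exposes W M P v → IsVertex P v
  exposed⇒vertex {W = W} {M} {P} {v} Pv dot-v exp = Pv , extremal
    where
    extremal : ∀ x y t → P x → P y → 0ℚ < t → t < 1ℚ → v ≈ ((t · x) ⊕ ((1ℚ - t) · y)) → (x ≈ v) × (y ≈ v)
    extremal x y t Px Py 0<t t<1 v≈ =
      tight exp Px (*-cancelˡ-≡-pos 0<t (proj₁ split)) ,
      tight exp Py (*-cancelˡ-≡-pos (x<1⇒0<1-x t<1) (proj₂ split))
      where
      combination : t * dot W x + (1ℚ - t) * dot W y ≡ t * M + (1ℚ - t) * M
      combination = begin
        t * dot W x + (1ℚ - t) * dot W y              ≡⟨ cong₂ _+_ (dot-· W x t) (dot-· W y (1ℚ - t)) ⟨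
        dot W (t · x) + dot W ((1ℚ - t) · y)          ≡⟨ dot-⊕ W (t · x) ((1ℚ - t) · y) ⟨
        dot W ((t · x) ⊕ ((1ℚ - t) · y))              ≡⟨ dot-cong W v≈ ⟨
        dot W v                                       ≡⟨ dot-v ⟩
        M                                             ≡⟨ solve 2 (λ t M → M := t :* M :+ (con 1ℚ :- t) :* M) refl t M ⟩
        t * M + (1ℚ - t) * M                          ∎
        where open ≡-Reasoning
      split = +-tight-≤ (*-monoˡ-≤-nonNeg′ (ℚ.<⇒≤ 0<t) (bound exp Px))
                        (*-monoˡ-≤-nonNeg′ (ℚ.<⇒≤ (x<1⇒0<1-x t<1)) (bound exp Py)) combination

module HullVertices where

  open Points
  open RationalOrder
  open import Data.Rational using (ℚ; 0ℚ; 1ℚ; _+_; _*_; _-_; _≤_; _<_; 1/_; positive)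
  import Data.Rational.Properties as ℚ
  open import Data.Rational.Solver using (module +-*-Solver)
  open import Data.Product using (_×_; _,_; proj₁; proj₂; Σ)
  open import Data.List using (List; []; _∷_)
  open import Data.List.Relation.Unary.All using (All; []; _∷_)
  open import Relation.Binary.Definitions using (tri<; tri≈; tri>)
  open import Relation.Binary.PropositionalEquality
  open import Relation.Nullary using (contradiction)
  open +-*-Solver

  +ₘ-resp-≈ : ∀ {n} {A B : PSet n} {x y} → x ≈ y → (A +ₘ B) x → (A +ₘ B) y
  +ₘ-resp-≈ x≈y (a , b , Aa , Bb , x≈a⊕b) = a , b , Aa , Bb , ≈-trans (≈-sym x≈y) x≈a⊕b

  IsVertex-resp-≈ : ∀ {n} {P : PSet n} {u v} → (∀ {x y} → x ≈ y → P x → P y) → u ≈ v → IsVertex P u → IsVertex P v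
  IsVertex-resp-≈ P-resp u≈v (Pu , extremal) =
    P-resp u≈v Pu ,
    λ x y t Px Py 0<t t<1 v≈ → let x≈u , y≈u = extremal x y t Px Py 0<t t<1 (≈-trans u≈v v≈)
                               in ≈-trans x≈u u≈v , ≈-trans y≈u u≈v

  module _ {n} {S : PSet n} where

    conv-singleton : ∀ {s} → S s → conv S s
    conv-singleton {s} Ss =
      ((1ℚ , s) ∷ []) , (ℚ.<⇒≤ (ℚ.positive⁻¹ 1ℚ) , Ss) ∷ [] , ℚ.+-identityʳ 1ℚ ,
      ≈-sym (≈-trans (⊕-identityʳ (1ℚ · s)) (·-identityˡ s))

    wtotal-nonNeg : ∀ L → All (WeightedIn S) L → 0ℚ ≤ wtotal L
    wtotal-nonNeg [] [] = ℚ.≤-refl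
    wtotal-nonNeg (_ ∷ L) ((0≤c , _) ∷ AL) = ℚ.+-mono-≤ 0≤c (wtotal-nonNeg L AL)

    wsum-zero-total : ∀ L → All (WeightedIn S) L → wtotal L ≡ 0ℚ → wsum L ≈ origin
    wsum-zero-total [] [] _ = ≈-refl
    wsum-zero-total ((c , s) ∷ L) ((0≤c , _) ∷ AL) total≡0 =
      ≈-trans (⊕-cong (subst (λ c → (c · s) ≈ origin) c≡0 (·-zeroˡ s)) (wsum-zero-total L AL rest≡0))
              (⊕-identityʳ origin)
      where
      split = +-tight-≤ 0≤c (wtotal-nonNeg L AL) (trans (ℚ.+-identityʳ 0ℚ) (sym total≡0))
      c≡0 = proj₁ split
      rest≡0 = sym (proj₂ split)

    scaleWeights : ℚ → List (ℚ × Pt n) → List (ℚ × Pt n)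
    scaleWeights r [] = []
    scaleWeights r ((c , s) ∷ L) = (r * c , s) ∷ scaleWeights r L

    wtotal-scaleWeights : ∀ r L → wtotal (scaleWeights r L) ≡ r * wtotal L
    wtotal-scaleWeights r [] = sym (ℚ.*-zeroʳ r)
    wtotal-scaleWeights r ((c , _) ∷ L) =
      trans (cong (r * c +_) (wtotal-scaleWeights r L)) (sym (ℚ.*-distribˡ-+ r c (wtotal L)))

    wsum-scaleWeights : ∀ r L → wsum (scaleWeights r L) ≈ (r · wsum L)
    wsum-scaleWeights r [] = ≈-sym (·-zeroʳ r)
    wsum-scaleWeights r ((c , s) ∷ L) =
      ≈-trans (⊕-cong (≈-sym (·-assoc r c s)) (wsum-scaleWeights r L)) (≈-sym (·-distribˡ-⊕ r (c · s) (wsum L)))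

    All-scaleWeights : ∀ {r} L → 0ℚ ≤ r → All (WeightedIn S) L → All (WeightedIn S) (scaleWeights r L)
    All-scaleWeights [] _ [] = []
    All-scaleWeights {r} ((c , _) ∷ L) 0≤r ((0≤c , Ss) ∷ AL) =
      (subst (_≤ r * c) (ℚ.*-zeroʳ r) (*-monoˡ-≤-nonNeg′ 0≤r 0≤c) , Ss) ∷ All-scaleWeights L 0≤r AL

    wsum-normalise : ∀ L → All (WeightedIn S) L → 0ℚ < wtotal L →
                     Σ (Pt n) λ z → conv S z × (wsum L ≈ (wtotal L · z))
    wsum-normalise L AL 0<d = wsum L′ , (L′ , All-scaleWeights L 0≤r AL , total′ , ≈-refl) , back
      where
      d = wtotal L
      instance
        _ = positive 0<d
        _ = ℚ.pos⇒nonZero d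
      r = 1/ d
      0≤r : 0ℚ ≤ r
      0≤r = ℚ.<⇒≤ (ℚ.positive⁻¹ r {{ℚ.1/pos⇒pos d}})
      L′ = scaleWeights r L
      total′ : wtotal L′ ≡ 1ℚ
      total′ = trans (wtotal-scaleWeights r L) (ℚ.*-inverseˡ d)
      back : wsum L ≈ (d · wsum L′)
      back = ≈-sym (≈-trans (·-congˡ d (wsum-scaleWeights r L)) (≈-trans (·-assoc d r (wsum L))
                   (subst (λ z → (z · wsum L) ≈ wsum L) (sym (ℚ.*-inverseʳ d)) (·-identityˡ (wsum L)))))

  module _ {n} {K S : PSet n} {v t : Pt n} (vertex : IsVertex K v) (hull⊆K : ∀ z → conv S z → K (t ⊕ z)) where

    private
      Translate : Set
      Translate = Σ (Pt n) λ s → S s × (v ≈ (t ⊕ s))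

      remaining-weight : ∀ c {w} → c + w ≡ 1ℚ → w ≡ 1ℚ - c
      remaining-weight c {w} total = trans (solve 2 (λ c w → w := (c :+ w) :- c) refl c w) (cong (_- c) total)

    translate-combination : ∀ c (p q : Pt n) →
                            (t ⊕ ((c · p) ⊕ ((1ℚ - c) · q))) ≈ ((c · (t ⊕ p)) ⊕ ((1ℚ - c) · (t ⊕ q)))
    translate-combination c (x , y) (x′ , y′) =
      (λ i → affine (proj₁ t i) (x i) (x′ i)) , (λ i → affine (proj₂ t i) (y i) (y′ i))
      where
      affine : ∀ a b b′ → a + (c * b + (1ℚ - c) * b′) ≡ c * (a + b) + (1ℚ - c) * (a + b′)
      affine = solve 4 (λ c a b b′ → a :+ (c :* b :+ (con 1ℚ :- c) :* b′)
                                     := c :* (a :+ b) :+ (con 1ℚ :- c) :* (a :+ b′)) refl c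

    vertex-from-weights : ∀ L → All (WeightedIn S) L → wtotal L ≡ 1ℚ → v ≈ (t ⊕ wsum L) → Translate
    vertex-from-weights [] [] total _ = contradiction (sym total) ℚ.1≢0
    vertex-from-weights ((c , s) ∷ L) ((0≤c , Ss) ∷ AL) total v≈ with ℚ.<-cmp c 1ℚ
    ... | tri> _ _ 1<c = contradiction (ℚ.<-≤-trans 1<c c≤1) (ℚ.<-irrefl refl)
      where
      c≤1 : c ≤ 1ℚ
      c≤1 = subst₂ _≤_ (ℚ.+-identityʳ c) total (ℚ.+-monoʳ-≤ c (wtotal-nonNeg L AL))
    ... | tri≈ _ refl _ = s , Ss , ≈-trans v≈ (⊕-congˡ t (≈-trans (⊕-cong (·-identityˡ s) rest≈0) (⊕-identityʳ s)))
      where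
      rest≈0 : wsum L ≈ origin
      rest≈0 = wsum-zero-total L AL (trans (remaining-weight 1ℚ total) (ℚ.+-inverseʳ 1ℚ))
    ... | tri< c<1 _ _ with ℚ.<-cmp 0ℚ c
    ...   | tri≈ _ refl _ =
      vertex-from-weights L AL (trans (sym (ℚ.+-identityˡ (wtotal L))) total)
        (≈-trans v≈ (⊕-congˡ t (≈-trans (⊕-congʳ (wsum L) (·-zeroˡ s)) (⊕-identityˡ (wsum L)))))
    ...   | tri> _ _ c<0 = contradiction (ℚ.<-≤-trans c<0 0≤c) (ℚ.<-irrefl refl)
    ...   | tri< 0<c _ _ = s , Ss , ≈-sym (proj₁ (proj₂ vertex (t ⊕ s) (t ⊕ z) c
                                    (hull⊆K s (conv-singleton Ss)) (hull⊆K z hull-z) 0<c c<1 split))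
      where
      rest≡1-c = remaining-weight c total
      normalised = wsum-normalise L AL (subst (0ℚ <_) (sym rest≡1-c) (x<1⇒0<1-x c<1))
      z = proj₁ normalised
      hull-z = proj₁ (proj₂ normalised)
      split : v ≈ ((c · (t ⊕ s)) ⊕ ((1ℚ - c) · (t ⊕ z)))
      split = ≈-trans v≈ (≈-trans (⊕-congˡ t (⊕-congˡ (c · s)
                (subst (λ w → wsum L ≈ (w · z)) rest≡1-c (proj₂ (proj₂ normalised)))))
                (translate-combination c s z))

    vertex-of-translated-hull : ∀ {z} → conv S z → v ≈ (t ⊕ z) → Translate
    vertex-of-translated-hull (L , AL , total , z≈) v≈ = vertex-from-weights L AL total (≈-trans v≈ (⊕-congˡ t z≈))

module Permutations where

  open import Data.Fin using (Fin; _≟_)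
  open import Data.Fin.Properties using (toℕ-injective)
  open import Data.Fin.Permutation as P using (Permutation′; _⟨$⟩ʳ_)
  import Data.Fin.Permutation.Components as PC
  open import Relation.Binary.PropositionalEquality
  open import Relation.Nullary using (yes; no)
  open import Relation.Nullary.Decidable using (dec-true; dec-false)

  module _ {n} (i j : Fin n) where

    transpose-applyˡ : PC.transpose i j i ≡ j
    transpose-applyˡ rewrite dec-true (i ≟ i) refl = refl

    transpose-applyʳ : PC.transpose i j j ≡ i
    transpose-applyʳ with j ≟ i
    ... | yes j≡i = j≡i
    ... | no _ rewrite dec-true (j ≟ j) refl = refl

    transpose-applyᵒ : ∀ {k} → k ≢ i → k ≢ j → PC.transpose i j k ≡ k
    transpose-applyᵒ {k} k≢i k≢j rewrite dec-false (k ≟ i) k≢i | dec-false (k ≟ j) k≢j = refl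

  pos-injective : ∀ {n} (π : Permutation′ n) {i j} → pos π i ≡ pos π j → i ≡ j
  pos-injective π {i} {j} eq = trans (sym (P.inverseʳ π)) (trans (cong (π ⟨$⟩ʳ_) (toℕ-injective eq)) (P.inverseʳ π))

module Rearrangement where

  open Permutations
  open import Data.Nat as ℕ using (ℕ; zero; suc; _+_; _*_; _≤_; _<_; z≤n)
  import Data.Nat.Properties as ℕ
  open import Data.Fin as Fin using (Fin; zero; suc; toℕ; punchIn)
  import Data.Fin.Properties as Fin
  open import Data.Fin.Permutation as P using (Permutation′; _⟨$⟩ʳ_; _⟨$⟩ˡ_; _∘ₚ_; remove; transpose)
  import Data.Fin.Permutation.Components as PC
  open import Data.Sum using (_⊎_; inj₁; inj₂)
  open import Data.Product using (_×_; _,_)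
  open import Function using (id; _∘_)
  open import Relation.Binary using (_Preserves_⟶_)
  open import Relation.Binary.PropositionalEquality
  open import Relation.Nullary using (yes; no; contradiction)

  open FiniteSums using (module ℕΣ)
  open ℕΣ using (sum; sum-cong-≗; ∑-distrib-+; sum-permute)

  sum-mono-≤ : ∀ {n} {f g : Fin n → ℕ} → (∀ i → f i ≤ g i) → sum f ≤ sum g
  sum-mono-≤ {zero} _ = z≤n
  sum-mono-≤ {suc n} f≤g = ℕ.+-mono-≤ (f≤g zero) (sum-mono-≤ (f≤g ∘ suc))

  sum-mono-< : ∀ {n} {f g : Fin n → ℕ} → (∀ i → f i ≤ g i) → ∀ m → f m < g m → sum f < sum g
  sum-mono-< {suc n} f≤g zero fm<gm = ℕ.+-mono-<-≤ fm<gm (sum-mono-≤ (f≤g ∘ suc))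
  sum-mono-< {suc n} f≤g (suc m) fm<gm = ℕ.+-mono-≤-< (f≤g zero) (sum-mono-< (f≤g ∘ suc) m fm<gm)

  weigh : ∀ {n} → (Fin n → ℕ) → (Fin n → Fin n) → ℕ
  weigh g f = sum (λ m → g m * toℕ (f m))

  weigh-split : ∀ {n} (g : Fin (suc n) → ℕ) (f : Fin (suc n) → Fin (suc n)) (f′ : Fin n → Fin n) →
                f zero ≡ zero → (∀ m → f (suc m) ≡ suc (f′ m)) → weigh g f ≡ sum (g ∘ suc) + weigh (g ∘ suc) f′
  weigh-split g f f′ f0≡0 f-suc = begin
    g zero * toℕ (f zero) + sum (λ m → g (suc m) * toℕ (f (suc m)))
      ≡⟨ cong₂ _+_ (cong (λ x → g zero * toℕ x) f0≡0)
                   (sum-cong-≗ (λ m → cong (λ x → g (suc m) * toℕ x) (f-suc m))) ⟩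
    g zero * 0 + sum (λ m → g (suc m) * suc (toℕ (f′ m)))
      ≡⟨ cong₂ _+_ (ℕ.*-zeroʳ (g zero)) (sum-cong-≗ (λ m → ℕ.*-suc (g (suc m)) (toℕ (f′ m)))) ⟩
    sum (λ m → g (suc m) + g (suc m) * toℕ (f′ m))
      ≡⟨ ∑-distrib-+ (g ∘ suc) (λ m → g (suc m) * toℕ (f′ m)) ⟩
    sum (g ∘ suc) + weigh (g ∘ suc) f′ ∎
    where open ≡-Reasoning

  remove-zero-suc : ∀ {n} (τ : Permutation′ (suc n)) → τ ⟨$⟩ʳ zero ≡ zero →
                    ∀ m → τ ⟨$⟩ʳ suc m ≡ suc (remove zero τ ⟨$⟩ʳ m)
  remove-zero-suc τ τ0≡0 m = trans (P.punchIn-permute τ zero m) (cong (λ x → punchIn x (remove zero τ ⟨$⟩ʳ m)) τ0≡0)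

  Rearranged : ∀ {n} → (Fin n → ℕ) → Permutation′ n → Set
  Rearranged g τ = (∀ m → τ ⟨$⟩ʳ m ≡ m) ⊎ weigh g (τ ⟨$⟩ʳ_) < weigh g id

  transpose-zero-≤ : ∀ {n} (j : Fin (suc n)) {k} → k ≢ zero → toℕ (PC.transpose zero j k) ≤ toℕ k
  transpose-zero-≤ j {k} k≢0 with k Fin.≟ j
  ... | yes refl = subst (λ x → toℕ x ≤ toℕ k) (sym (transpose-applyʳ zero k)) z≤n
  ... | no k≢j = ℕ.≤-reflexive (cong toℕ (transpose-applyᵒ zero j k≢0 k≢j))

  module _ {n} (g : Fin (suc n) → ℕ) (g↑ : g Preserves Fin._<_ ⟶ ℕ._<_) where

    g-mono : ∀ {i j} → toℕ i ≤ toℕ j → g i ≤ g j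
    g-mono {i} {j} i≤j with ℕ.m≤n⇒m<n∨m≡n i≤j
    ... | inj₁ i<j = ℕ.<⇒≤ (g↑ i<j)
    ... | inj₂ i≡j = ℕ.≤-reflexive (cong g (Fin.toℕ-injective i≡j))

    rearrangement-fixing-zero : (τ : Permutation′ (suc n)) → τ ⟨$⟩ʳ zero ≡ zero →
                                Rearranged (g ∘ suc) (remove zero τ) → Rearranged g τ
    rearrangement-fixing-zero τ τ0≡0 (inj₁ τ′≗id) = inj₁ λ where
      zero → τ0≡0
      (suc m) → trans (remove-zero-suc τ τ0≡0 m) (cong suc (τ′≗id m))
    rearrangement-fixing-zero τ τ0≡0 (inj₂ τ′<id) =
      inj₂ (subst₂ _<_ (sym (weigh-split g (τ ⟨$⟩ʳ_) (remove zero τ ⟨$⟩ʳ_) τ0≡0 (remove-zero-suc τ τ0≡0)))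
                        (sym (weigh-split g id id refl (λ _ → refl)))
                   (ℕ.+-monoʳ-< (sum (g ∘ suc)) τ′<id))

    Rearranged⇒≤ : ∀ τ → Rearranged g τ → weigh g (τ ⟨$⟩ʳ_) ≤ weigh g id
    Rearranged⇒≤ _ (inj₁ τ≗id) = ℕ.≤-reflexive (sum-cong-≗ (λ m → cong (λ x → g m * toℕ x) (τ≗id m)))
    Rearranged⇒≤ _ (inj₂ τ<id) = ℕ.<⇒≤ τ<id

    module _ (τ : Permutation′ (suc n)) (τ0≢0 : τ ⟨$⟩ʳ zero ≢ zero) where

      private
        m₀ = τ ⟨$⟩ˡ zero
        t = transpose zero m₀

      m₀≢0 : m₀ ≢ zero
      m₀≢0 m₀≡0 = τ0≢0 (trans (cong (τ ⟨$⟩ʳ_) (sym m₀≡0)) (P.inverseʳ τ))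

      exchanged : Permutation′ (suc n)
      exchanged = t ∘ₚ τ

      exchanged-fixes-zero : exchanged ⟨$⟩ʳ zero ≡ zero
      exchanged-fixes-zero = P.inverseʳ τ

      -- Reindexing the sum by t, no term decreases (t moves only m₀, down to 0) and the term at m₀ increases.
      exchange-increases : weigh g (τ ⟨$⟩ʳ_) < weigh g (exchanged ⟨$⟩ʳ_)
      exchange-increases =
        subst (_< weigh g (exchanged ⟨$⟩ʳ_)) (sym (sum-permute (λ m → g m * toℕ (τ ⟨$⟩ʳ m)) t))
              (sum-mono-< pointwise m₀ at-m₀)
        where
        pointwise : ∀ m → g (t ⟨$⟩ʳ m) * toℕ (exchanged ⟨$⟩ʳ m) ≤ g m * toℕ (exchanged ⟨$⟩ʳ m)
        pointwise zero rewrite exchanged-fixes-zero =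
          ℕ.≤-reflexive (trans (ℕ.*-zeroʳ (g m₀)) (sym (ℕ.*-zeroʳ (g zero))))
        pointwise (suc m) = ℕ.*-monoˡ-≤ (toℕ (exchanged ⟨$⟩ʳ suc m)) (g-mono (transpose-zero-≤ m₀ (λ ())))
        at-m₀ : g (t ⟨$⟩ʳ m₀) * toℕ (exchanged ⟨$⟩ʳ m₀) < g m₀ * toℕ (exchanged ⟨$⟩ʳ m₀)
        at-m₀ rewrite transpose-applyʳ zero m₀ =
          ℕ.*-monoˡ-< (toℕ (τ ⟨$⟩ʳ zero)) {{ℕ.≢-nonZero (≢0 τ0≢0)}} (g↑ (ℕ.n≢0⇒n>0 (≢0 m₀≢0)))
          where
          ≢0 : ∀ {x : Fin (suc n)} → x ≢ zero → toℕ x ≢ 0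
          ≢0 x≢0 e = x≢0 (Fin.toℕ-injective e)

    rearrangement-step : (∀ τ′ → Rearranged (g ∘ suc) τ′) → ∀ τ → Rearranged g τ
    rearrangement-step ih τ with τ ⟨$⟩ʳ zero Fin.≟ zero
    ... | yes τ0≡0 = rearrangement-fixing-zero τ τ0≡0 (ih (remove zero τ))
    ... | no τ0≢0 =
      inj₂ (ℕ.<-≤-trans (exchange-increases τ τ0≢0) (Rearranged⇒≤ (exchanged τ τ0≢0) exchanged-rearranged))
      where
      exchanged-rearranged : Rearranged g (exchanged τ τ0≢0)
      exchanged-rearranged = rearrangement-fixing-zero (exchanged τ τ0≢0) (exchanged-fixes-zero τ τ0≢0)
                                                       (ih (remove zero (exchanged τ τ0≢0)))

  rearrangement : ∀ {n} (g : Fin n → ℕ) → g Preserves Fin._<_ ⟶ ℕ._<_ → (τ : Permutation′ n) → Rearranged g τ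
  rearrangement {zero} g g↑ τ = inj₁ λ ()
  rearrangement {suc n} g g↑ = rearrangement-step g g↑ (rearrangement (g ∘ suc) (g↑ ∘ ℕ.s<s))

  module _ {n} (w : Fin n → ℕ) (π : Permutation′ n)
           (w↑ : ∀ {i j} → pos π i < pos π j → w i < w j) where

    private
      g : Fin n → ℕ
      g m = w (π ⟨$⟩ʳ m)

      g↑ : g Preserves Fin._<_ ⟶ ℕ._<_
      g↑ = w↑ ∘ subst₂ (λ a b → toℕ a < toℕ b) (sym (P.inverseˡ π)) (sym (P.inverseˡ π))

    inverse-maximises-weigh : ∀ σ → weigh w (σ ⟨$⟩ʳ_) ≤ weigh w (π ⟨$⟩ˡ_) ×
                                    (weigh w (σ ⟨$⟩ʳ_) ≡ weigh w (π ⟨$⟩ˡ_) → ∀ j → σ ⟨$⟩ʳ j ≡ π ⟨$⟩ˡ j)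
    inverse-maximises-weigh σ with rearrangement g g↑ (π ∘ₚ σ)
    ... | inj₁ πσ≗id =
      ℕ.≤-reflexive (sum-cong-≗ (λ j → cong (λ x → w j * toℕ x) (σ≗π⁻¹ j))) , λ _ → σ≗π⁻¹
      where
      σ≗π⁻¹ : ∀ j → σ ⟨$⟩ʳ j ≡ π ⟨$⟩ˡ j
      σ≗π⁻¹ j = trans (cong (σ ⟨$⟩ʳ_) (sym (P.inverseʳ π))) (πσ≗id (π ⟨$⟩ˡ j))
    ... | inj₂ πσ<id = ℕ.<⇒≤ σ<π⁻¹ , λ eq → contradiction eq (ℕ.<⇒≢ σ<π⁻¹)
      where
      σ<π⁻¹ : weigh w (σ ⟨$⟩ʳ_) < weigh w (π ⟨$⟩ˡ_)
      σ<π⁻¹ = subst₂ _<_ (sym (sum-permute (λ j → w j * toℕ (σ ⟨$⟩ʳ j)) π)) (sym π⁻¹-weigh) πσ<id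
        where
        π⁻¹-weigh : weigh w (π ⟨$⟩ˡ_) ≡ weigh g id
        π⁻¹-weigh = trans (sum-permute (λ j → w j * toℕ (π ⟨$⟩ˡ j)) π)
                          (sum-cong-≗ (λ m → cong (λ x → g m * toℕ x) (P.inverseˡ π)))

module HarmonicPolytope where

  open import Data.Nat using (ℕ)
  open import Data.Fin using (Fin)
  open import Data.Fin.Permutation using (Permutation′)
  open import Data.Product using (_×_; _,_; Σ; proj₁; proj₂)
  open HullVertices using (+ₘ-resp-≈; IsVertex-resp-≈)

  DGen : (n : ℕ) → PSet n
  DGen n p = Σ (Fin n) λ i → p ≈ ef i

  PiPiGen : (n : ℕ) → PSet n
  PiPiGen n p = PermVerts n (proj₁ p) × PermVerts n (proj₂ p)

  GeneratorSum : (n : ℕ) → Pt n → Set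
  GeneratorSum n v = Σ (Fin n) λ k → Σ (Permutation′ n) λ σ → Σ (Permutation′ n) λ ρ → v ≈ (ef k ⊕ (oneLine σ , oneLine ρ))

  FineTripleAt : (n : ℕ) → Pt n → Set
  FineTripleAt n v =
    Σ (Fin n) λ k → Σ (Permutation′ n) λ π₁ → Σ (Permutation′ n) λ π₂ → FineHarmonic n k π₁ π₂ × (v ≈ vτ k π₁ π₂)

  H-vertex-resp-≈ : ∀ {n} {u v : Pt n} → u ≈ v → IsVertex (H n) u → IsVertex (H n) v
  H-vertex-resp-≈ {n} = IsVertex-resp-≈ {P = H n} (+ₘ-resp-≈ {A = D n} {B = PiPi n})

module Kronecker where

  open Points
  open import Data.Nat using (suc)
  open import Data.Fin as Fin using (Fin; punchIn)
  import Data.Fin.Properties as Fin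
  open import Data.Rational using (ℚ; 0ℚ; 1ℚ; _+_; _*_)
  import Data.Rational.Properties as ℚ
  open import Relation.Binary.PropositionalEquality
  open import Relation.Nullary using (yes; no; contradiction)
  open import Function using (_∘_)
  open FiniteSums using (module ℚΣ)
  open ℚΣ using (sum; sum-cong-≗; sum-remove; sum-replicate-zero)

  δ-diag : ∀ {n} (i : Fin n) → δ i i ≡ 1ℚ
  δ-diag i with i Fin.≟ i
  ... | yes _ = refl
  ... | no i≢i = contradiction refl i≢i

  δ-off : ∀ {n} {i j : Fin n} → i ≢ j → δ i j ≡ 0ℚ
  δ-off {i = i} {j} i≢j with i Fin.≟ j
  ... | yes i≡j = contradiction i≡j i≢j
  ... | no _ = refl

  inner-δ : ∀ {n} (w : Fin n → ℚ) i → inner w (δ i) ≡ w i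
  inner-δ {suc n} w i = begin
    inner w (δ i)                                         ≡⟨ sum-remove {n} {i} (λ j → w j * δ i j) ⟩
    w i * δ i i + sum (λ j → w (punchIn i j) * δ i (punchIn i j))
      ≡⟨ cong₂ _+_ (trans (cong (w i *_) (δ-diag i)) (ℚ.*-identityʳ (w i))) (sum-cong-≗ {n} off-diagonal) ⟩
    w i + sum {n} (λ _ → 0ℚ)                              ≡⟨ cong (w i +_) (sum-replicate-zero n) ⟩
    w i + 0ℚ                                              ≡⟨ ℚ.+-identityʳ (w i) ⟩
    w i                                                   ∎
    where
    open ≡-Reasoning
    off-diagonal : ∀ j → w (punchIn i j) * δ i (punchIn i j) ≡ 0ℚ
    off-diagonal j = trans (cong (w (punchIn i j) *_) (δ-off (Fin.punchInᵢ≢i i j ∘ sym))) (ℚ.*-zeroʳ (w (punchIn i j)))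

module HarmonicWeights where

  open Permutations using (pos-injective)
  open import Data.Nat using (ℕ; _+_; _≤_; _<_; _≤?_)
  import Data.Nat.Properties as ℕ
  open import Data.Fin using (Fin)
  open import Data.Fin.Properties using (toℕ<n)
  open import Data.Fin.Permutation using (Permutation′; _⟨$⟩ˡ_)
  open import Data.Product using (proj₁)
  open import Relation.Binary.PropositionalEquality
  open import Relation.Nullary using (¬_; Dec; yes; no; contradiction)
  open import Algebra.Properties.CommutativeSemigroup ℕ.+-commutativeSemigroup using (xy∙z≈xz∙y)

  raise : ℕ → ℕ → ℕ → ℕ
  raise M a b with a ≤? b
  ... | yes _ = b + M
  ... | no _ = b

  module _ (M a : ℕ) where

    raise-yes : ∀ {b} → a ≤ b → raise M a b ≡ b + M
    raise-yes {b} a≤b with a ≤? b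
    ... | yes _ = refl
    ... | no a≰b = contradiction a≤b a≰b

    raise-no : ∀ {b} → ¬ a ≤ b → raise M a b ≡ b
    raise-no {b} a≰b with a ≤? b
    ... | yes a≤b = contradiction a≤b a≰b
    ... | no _ = refl

    raise-≤ : ∀ b → raise M a b ≤ b + M
    raise-≤ b with a ≤? b
    ... | yes _ = ℕ.≤-refl
    ... | no _ = ℕ.m≤m+n b M

    raise-strictMono : ∀ {b b′} → b < b′ → raise M a b < raise M a b′
    raise-strictMono {b} {b′} b<b′ with a ≤? b | a ≤? b′
    ... | yes _ | yes _ = ℕ.+-monoˡ-< M b<b′
    ... | yes a≤b | no a≰b′ = contradiction (ℕ.≤-trans a≤b (ℕ.<⇒≤ b<b′)) a≰b′
    ... | no _ | yes _ = ℕ.<-≤-trans b<b′ (ℕ.m≤m+n b′ M)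
    ... | no _ | no _ = b<b′

  harmonicWeight : ∀ {n} → Fin n → Permutation′ n → Fin n → ℕ
  harmonicWeight {n} k π j = raise (n + n) (pos π k) (pos π j)

  harmonicWeight-ordered : ∀ {n} (k : Fin n) π {i j} → pos π i < pos π j → harmonicWeight k π i < harmonicWeight k π j
  harmonicWeight-ordered {n} k π = raise-strictMono (n + n) (pos π k)

  module _ {n} {k : Fin n} {π₁ π₂ : Permutation′ n} (fine : FineHarmonic n k π₁ π₂) where

    private
      M = n + n
      w₁ = harmonicWeight k π₁
      w₂ = harmonicWeight k π₂

    harmonicWeight-peak : ∀ {i} → i ≢ k → w₁ i + w₂ i < w₁ k + w₂ k
    harmonicWeight-peak {i} i≢k = ℕ.≤-<-trans at-most-one-raise (ℕ.<-≤-trans (ℕ.+-monoˡ-< M positions<M) raised-at-k)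
      where
      positions<M : pos π₁ i + pos π₂ i < M
      positions<M = ℕ.+-mono-< (toℕ<n (π₁ ⟨$⟩ˡ i)) (toℕ<n (π₂ ⟨$⟩ˡ i))
      raised-at-k : M + M ≤ w₁ k + w₂ k
      raised-at-k = ℕ.+-mono-≤ (raised π₁) (raised π₂)
        where
        raised : ∀ π → M ≤ harmonicWeight k π k
        raised π = subst (M ≤_) (sym (raise-yes M (pos π k) ℕ.≤-refl)) (ℕ.m≤n+m M (pos π k))
      at-most-one-raise : w₁ i + w₂ i ≤ (pos π₁ i + pos π₂ i) + M
      at-most-one-raise = by-cases (pos π₁ k ≤? pos π₁ i)
        where
        by-cases : Dec (pos π₁ k ≤ pos π₁ i) → w₁ i + w₂ i ≤ (pos π₁ i + pos π₂ i) + M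
        by-cases (yes k≤i) = subst₂ _≤_ (cong (w₁ i +_) (sym (raise-no M (pos π₂ k) (ℕ.<⇒≱ i<k₂))))
                                        (xy∙z≈xz∙y (pos π₁ i) M (pos π₂ i))
                                        (ℕ.+-monoˡ-≤ (pos π₂ i) (raise-≤ M (pos π₁ k) (pos π₁ i)))
          where
          i<k₂ : pos π₂ i < pos π₂ k
          i<k₂ = proj₁ (fine i i≢k) (ℕ.≤∧≢⇒< k≤i (λ eq → i≢k (sym (pos-injective π₁ eq))))
        by-cases (no k≰i) = subst₂ _≤_ (cong (_+ w₂ i) (sym (raise-no M (pos π₁ k) k≰i)))
                                       (sym (ℕ.+-assoc (pos π₁ i) (pos π₂ i) M))
                                       (ℕ.+-monoʳ-≤ (pos π₁ i) (raise-≤ M (pos π₂ k) (pos π₂ i)))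

module FineTriplesAreVertices where

  open FiniteSums
  open NatEmbedding
  open Points
  open RationalOrder
  open Exposure
  open HullVertices using (conv-singleton)
  open Rearrangement using (weigh; inverse-maximises-weigh)
  open Kronecker
  open HarmonicPolytope
  open HarmonicWeights
  open import Data.Nat as ℕ using (ℕ; suc)
  import Data.Nat.Properties as ℕ
  open import Data.Fin as Fin using (Fin; toℕ)
  open import Data.Fin.Permutation using (Permutation′; _⟨$⟩ʳ_; _⟨$⟩ˡ_; flip)
  open import Data.Rational using (_+_; _*_; _≤_; _<_)
  import Data.Rational.Properties as ℚ
  open import Data.Product using (_×_; _,_; proj₁; proj₂)
  open import Function using (_∘_)
  open import Relation.Binary.PropositionalEquality
  open import Relation.Nullary using (yes; no; contradiction)

  inner-permutationVector : ∀ {n} (w : Fin n → ℕ) (f : Fin n → Fin n) →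
    inner (ℕtoℚ ∘ w) (λ j → ℕtoℚ (suc (toℕ (f j)))) ≡ ℕtoℚ (ℕΣ.sum w ℕ.+ weigh w f)
  inner-permutationVector w f = begin
    ℚΣ.sum (λ j → ℕtoℚ (w j) * ℕtoℚ (suc (toℕ (f j))))  ≡⟨ ℚΣ.sum-cong-≗ (λ j → ℕtoℚ-homo-* (w j) _) ⟨
    ℚΣ.sum (λ j → ℕtoℚ (w j ℕ.* suc (toℕ (f j))))       ≡⟨ ℕtoℚ-sum (λ j → w j ℕ.* suc (toℕ (f j))) ⟩
    ℕtoℚ (ℕΣ.sum (λ j → w j ℕ.* suc (toℕ (f j))))       ≡⟨ cong ℕtoℚ (ℕΣ.sum-cong-≗ (λ j → ℕ.*-suc (w j) _)) ⟩
    ℕtoℚ (ℕΣ.sum (λ j → w j ℕ.+ w j ℕ.* toℕ (f j)))     ≡⟨ cong ℕtoℚ (ℕΣ.∑-distrib-+ w _) ⟩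
    ℕtoℚ (ℕΣ.sum w ℕ.+ weigh w f)                       ∎
    where open ≡-Reasoning

  module _ {n} (w : Fin n → ℕ) (π : Permutation′ n) (w↑ : ∀ {i j} → pos π i ℕ.< pos π j → w i ℕ.< w j) where

    private
      inner-w = inner (ℕtoℚ ∘ w)

    permutohedron-maximum : ∀ σ → inner-w (oneLine σ) ≤ inner-w (invVec π) ×
                                  (inner-w (oneLine σ) ≡ inner-w (invVec π) → ∀ i → oneLine σ i ≡ invVec π i)
    permutohedron-maximum σ =
      subst₂ _≤_ (sym (inner-permutationVector w (σ ⟨$⟩ʳ_))) (sym (inner-permutationVector w (π ⟨$⟩ˡ_)))
             (ℕtoℚ-mono-≤ (ℕ.+-monoʳ-≤ (ℕΣ.sum w) (proj₁ weigh-max))) ,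
      λ eq i → cong (λ x → ℕtoℚ (suc (toℕ x))) (proj₂ weigh-max (weigh-eq eq) i)
      where
      weigh-max = inverse-maximises-weigh w π w↑ σ
      weigh-eq : inner-w (oneLine σ) ≡ inner-w (invVec π) → weigh w (σ ⟨$⟩ʳ_) ≡ weigh w (π ⟨$⟩ˡ_)
      weigh-eq eq = ℕ.+-cancelˡ-≡ (ℕΣ.sum w) _ _ (ℕtoℚ-injective
        (trans (sym (inner-permutationVector w (σ ⟨$⟩ʳ_))) (trans eq (inner-permutationVector w (π ⟨$⟩ˡ_)))))

  module _ {n} (w₁ w₂ : Fin n → ℕ) where

    private
      W : Pt n
      W = ℕtoℚ ∘ w₁ , ℕtoℚ ∘ w₂

    PiPiGen-exposes : ∀ {π₁ π₂} → (∀ {i j} → pos π₁ i ℕ.< pos π₁ j → w₁ i ℕ.< w₁ j) →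
                      (∀ {i j} → pos π₂ i ℕ.< pos π₂ j → w₂ i ℕ.< w₂ j) →
                      Exposes W (dot W (invVec π₁ , invVec π₂)) (PiPiGen n) (invVec π₁ , invVec π₂)
    PiPiGen-exposes {π₁} {π₂} w₁↑ w₂↑ = record
      { bound = λ { ((σ , x₁≡) , (ρ , x₂≡)) →
          subst (_≤ _) (sym (dot-cong W (x₁≡ , x₂≡))) (ℚ.+-mono-≤ (proj₁ (max₁ σ)) (proj₁ (max₂ ρ))) }
      ; tight = λ { ((σ , x₁≡) , (ρ , x₂≡)) eq →
          let split = +-tight-≤ (proj₁ (max₁ σ)) (proj₁ (max₂ ρ)) (trans (sym (dot-cong W (x₁≡ , x₂≡))) eq)
          in (λ i → trans (x₁≡ i) (proj₂ (max₁ σ) (proj₁ split) i)) ,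
             (λ i → trans (x₂≡ i) (proj₂ (max₂ ρ) (proj₂ split) i)) }
      }
      where
      max₁ = permutohedron-maximum w₁ π₁ w₁↑
      max₂ = permutohedron-maximum w₂ π₂ w₂↑

    DGen-exposes : ∀ {k} → (∀ {i} → i ≢ k → w₁ i ℕ.+ w₂ i ℕ.< w₁ k ℕ.+ w₂ k) →
                   Exposes W (dot W (ef k)) (DGen n) (ef k)
    DGen-exposes {k} peak = record
      { bound = λ { (i , p≈eᵢ) → subst (_≤ _) (sym (dot-cong W p≈eᵢ)) (dot-ef≤ i) }
      ; tight = λ { (i , p≈eᵢ) eq → ≈-trans p≈eᵢ (ef-tight i (trans (sym (dot-cong W p≈eᵢ)) eq)) }
      }
      where
      dot-ef : ∀ j → dot W (ef j) ≡ ℕtoℚ (w₁ j ℕ.+ w₂ j)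
      dot-ef j = trans (cong₂ _+_ (inner-δ (ℕtoℚ ∘ w₁) j) (inner-δ (ℕtoℚ ∘ w₂) j))
                       (sym (ℕtoℚ-homo-+ (w₁ j) (w₂ j)))
      dot-ef< : ∀ {i} → i ≢ k → dot W (ef i) < dot W (ef k)
      dot-ef< {i} i≢k = subst₂ _<_ (sym (dot-ef i)) (sym (dot-ef k)) (ℕtoℚ-mono-< (peak i≢k))
      dot-ef≤ : ∀ i → dot W (ef i) ≤ dot W (ef k)
      dot-ef≤ i with i Fin.≟ k
      ... | yes refl = ℚ.≤-refl
      ... | no i≢k = ℚ.<⇒≤ (dot-ef< i≢k)
      ef-tight : ∀ i → dot W (ef i) ≡ dot W (ef k) → ef i ≈ ef k
      ef-tight i eq with i Fin.≟ k
      ... | yes refl = ≈-refl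
      ... | no i≢k = contradiction eq (ℚ.<⇒≢ (dot-ef< i≢k))

  fine⇒vertex : ∀ {n} {k : Fin n} {π₁ π₂} → FineHarmonic n k π₁ π₂ → IsVertex (H n) (vτ k π₁ π₂)
  fine⇒vertex {n} {k} {π₁} {π₂} fine =
    exposed⇒vertex {W = W} H-vτ (dot-⊕ W (ef k) (invVec π₁ , invVec π₂))
      (+ₘ-exposes (conv-exposes (DGen-exposes w₁ w₂ {k} (harmonicWeight-peak {k = k} {π₁} {π₂} fine)))
                  (conv-exposes (PiPiGen-exposes w₁ w₂ {π₁} {π₂} (harmonicWeight-ordered k π₁)
                                                                  (harmonicWeight-ordered k π₂))))
    where
    w₁ = harmonicWeight k π₁
    w₂ = harmonicWeight k π₂
    W : Pt n
    W = ℕtoℚ ∘ w₁ , ℕtoℚ ∘ w₂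
    H-vτ : H n (vτ k π₁ π₂)
    H-vτ = ef k , (invVec π₁ , invVec π₂) , conv-singleton (k , ≈-refl) ,
           conv-singleton ((flip π₁ , λ _ → refl) , (flip π₂ , λ _ → refl)) , ≈-refl

module TranspositionSteps where

  open NatEmbedding
  open Permutations
  open Kronecker
  open RationalOrder
  open import Data.Nat as ℕ using (suc)
  import Data.Nat.Properties as ℕ
  open import Data.Fin as Fin using (Fin; toℕ)
  open import Data.Fin.Permutation using (Permutation′; _⟨$⟩ʳ_; _∘ₚ_; transpose)
  import Data.Fin.Permutation.Components as PC
  open import Data.Rational using (ℚ; 0ℚ; 1ℚ; _+_; _*_; _-_; _≤_; _<_; 1/_; positive)
  import Data.Rational.Properties as ℚ
  open import Data.Rational.Solver using (module +-*-Solver)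
  open import Function using (_∘_)
  open import Relation.Binary.PropositionalEquality
  open import Relation.Nullary using (Dec; yes; no)
  open +-*-Solver

  record HalfStep {n} (k j : Fin n) (a a′ : Fin n → ℚ) : Set where
    field
      weight : ℚ
      0≤weight : 0ℚ ≤ weight
      weight+weight≤1 : weight + weight ≤ 1ℚ
      step : ∀ m → weight * (a′ m - a m) + weight * (a′ m - a m) ≡ δ k m - δ j m

  module TranspositionStep {n} (k j : Fin n) (j≢k : j ≢ k) (σ : Permutation′ n)
                           (σk<σj : toℕ (σ ⟨$⟩ʳ k) ℕ.< toℕ (σ ⟨$⟩ʳ j)) where

    private
      a a′ : Fin n → ℚ
      a = oneLine σ
      a′ = oneLine (transpose k j ∘ₚ σ)
      d = toℕ (σ ⟨$⟩ʳ j) ℕ.∸ toℕ (σ ⟨$⟩ʳ k)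

    gap : ℚ
    gap = ℕtoℚ d

    1≤gap : 1ℚ ≤ gap
    1≤gap = ℕtoℚ-mono-≤ (ℕ.m<n⇒0<n∸m σk<σj)

    a-gap : a j ≡ a k + gap
    a-gap = trans (cong (λ x → ℕtoℚ (suc x)) (sym (ℕ.m+[n∸m]≡n (ℕ.<⇒≤ σk<σj))))
                  (ℕtoℚ-homo-+ (suc (toℕ (σ ⟨$⟩ʳ k))) d)

    private
      Shifted : Fin n → Set
      Shifted m = a′ m ≡ a m + gap * (δ k m - δ j m)

      shifted-k : Shifted k
      shifted-k = begin
        a (PC.transpose k j k)           ≡⟨ cong a (transpose-applyˡ k j) ⟩
        a j                              ≡⟨ a-gap ⟩
        a k + gap                        ≡⟨ solve 2 (λ x g → x :+ g := x :+ g :* (con 1ℚ :- con 0ℚ)) refl (a k) gap ⟩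
        a k + gap * (1ℚ - 0ℚ)            ≡⟨ cong (λ e → a k + gap * e) (cong₂ _-_ (δ-diag k) (δ-off j≢k)) ⟨
        a k + gap * (δ k k - δ j k)      ∎
        where open ≡-Reasoning

      shifted-j : Shifted j
      shifted-j = begin
        a (PC.transpose k j j)           ≡⟨ cong a (transpose-applyʳ k j) ⟩
        a k                              ≡⟨ solve 2 (λ x g → x := (x :+ g) :+ g :* (con 0ℚ :- con 1ℚ)) refl (a k) gap ⟩
        (a k + gap) + gap * (0ℚ - 1ℚ)
          ≡⟨ cong₂ (λ x e → x + gap * e) a-gap (cong₂ _-_ (δ-off (j≢k ∘ sym)) (δ-diag j)) ⟨
        a j + gap * (δ k j - δ j j)      ∎
        where open ≡-Reasoning

      shifted-other : ∀ {m} → m ≢ k → m ≢ j → Shifted m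
      shifted-other {m} m≢k m≢j = begin
        a (PC.transpose k j m)           ≡⟨ cong a (transpose-applyᵒ k j m≢k m≢j) ⟩
        a m                              ≡⟨ solve 2 (λ x g → x := x :+ g :* (con 0ℚ :- con 0ℚ)) refl (a m) gap ⟩
        a m + gap * (0ℚ - 0ℚ)
          ≡⟨ cong (λ e → a m + gap * e) (cong₂ _-_ (δ-off (m≢k ∘ sym)) (δ-off (m≢j ∘ sym))) ⟨
        a m + gap * (δ k m - δ j m)      ∎
        where open ≡-Reasoning

    oneLine-transpose : ∀ m → a′ m ≡ a m + gap * (δ k m - δ j m)
    oneLine-transpose m = by-cases (m Fin.≟ k) (m Fin.≟ j)
      where
      by-cases : Dec (m ≡ k) → Dec (m ≡ j) → Shifted m
      by-cases (yes m≡k) _ = subst Shifted (sym m≡k) shifted-k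
      by-cases (no _) (yes m≡j) = subst Shifted (sym m≡j) shifted-j
      by-cases (no m≢k) (no m≢j) = shifted-other m≢k m≢j

    private
      0<2gap : 0ℚ < gap + gap
      0<2gap = ℚ.<-≤-trans (ℚ.positive⁻¹ (1ℚ + 1ℚ)) (ℚ.+-mono-≤ 1≤gap 1≤gap)
      instance
        _ = positive 0<2gap
        _ = ℚ.pos⇒nonZero (gap + gap)

    weight : ℚ
    weight = 1/ (gap + gap)

    0≤weight : 0ℚ ≤ weight
    0≤weight = ℚ.<⇒≤ (ℚ.positive⁻¹ weight {{ℚ.1/pos⇒pos (gap + gap)}})

    weight+weight≤1 : weight + weight ≤ 1ℚ
    weight+weight≤1 = begin
      weight + weight           ≡⟨ solve 1 (λ w → w :+ w := w :* (con 1ℚ :+ con 1ℚ)) refl weight ⟩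
      weight * (1ℚ + 1ℚ)        ≤⟨ *-monoˡ-≤-nonNeg′ 0≤weight (ℚ.+-mono-≤ 1≤gap 1≤gap) ⟩
      weight * (gap + gap)      ≡⟨ ℚ.*-inverseˡ (gap + gap) ⟩
      1ℚ                        ∎
      where open ℚ.≤-Reasoning

    half-step : ∀ m → weight * (a′ m - a m) + weight * (a′ m - a m) ≡ δ k m - δ j m
    half-step m = begin
      weight * (a′ m - a m) + weight * (a′ m - a m)
        ≡⟨ cong (λ x → weight * (x - a m) + weight * (x - a m)) (oneLine-transpose m) ⟩
      weight * (a m + gap * e - a m) + weight * (a m + gap * e - a m)
        ≡⟨ solve 4 (λ w x g e → w :* (x :+ g :* e :- x) :+ w :* (x :+ g :* e :- x) := w :* (g :+ g) :* e)
                   refl weight (a m) gap e ⟩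
      weight * (gap + gap) * e
        ≡⟨ cong (_* e) (ℚ.*-inverseˡ (gap + gap)) ⟩
      1ℚ * e
        ≡⟨ ℚ.*-identityˡ e ⟩
      e ∎
      where
      open ≡-Reasoning
      e = δ k m - δ j m

    halfStep : HalfStep k j a a′
    halfStep = record { weight = weight ; 0≤weight = 0≤weight ; weight+weight≤1 = weight+weight≤1 ; step = half-step }

module VerticesAreFine where

  open Points
  open HullVertices
  open Permutations
  open HarmonicPolytope
  open Kronecker
  open RationalOrder
  open TranspositionSteps
  import Data.Nat as ℕ
  import Data.Nat.Properties as ℕ
  open import Data.Integer using (+_)
  open import Data.Fin using (Fin; toℕ)
  open import Data.Fin.Permutation as P using (Permutation′; _⟨$⟩ʳ_; _∘ₚ_; transpose)
  open import Data.Rational using (ℚ; 0ℚ; 1ℚ; _+_; _*_; _-_; _/_)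
  import Data.Rational.Properties as ℚ
  open import Data.Rational.Solver using (module +-*-Solver)
  open import Data.Product using (_×_; _,_; proj₁; proj₂)
  open import Data.List using (List; []; _∷_)
  open import Data.List.Relation.Unary.All using ([]; _∷_)
  open import Data.Empty using (⊥)
  open import Function using (_∘_)
  open import Relation.Binary.PropositionalEquality
  open import Relation.Nullary using (¬_)
  open import Relation.Nullary.Decidable using (toWitness)
  open import Algebra.Properties.Group ℚ.+-0-group using (∙-cancelʳ)
  open +-*-Solver

  ⅓ : ℚ
  ⅓ = + 1 / 3

  trisect : ∀ dk dj x e → e + e ≡ dk - dj → dk + x ≡ ⅓ * (dj + x) + (1ℚ - ⅓) * (dk + (x + e))
  trisect dk dj x e e+e≡ = sym (begin
    ⅓ * (dj + x) + (1ℚ - ⅓) * (dk + (x + e))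
      ≡⟨ solve 4 (λ dk dj x e → con ⅓ :* (dj :+ x) :+ (con 1ℚ :- con ⅓) :* (dk :+ (x :+ e))
                                := dk :+ x :+ con ⅓ :* ((e :+ e) :- (dk :- dj))) refl dk dj x e ⟩
    dk + x + ⅓ * ((e + e) - (dk - dj))
      ≡⟨ cong (λ z → dk + x + ⅓ * (z - (dk - dj))) e+e≡ ⟩
    dk + x + ⅓ * ((dk - dj) - (dk - dj))
      ≡⟨ solve 3 (λ dk dj x → dk :+ x :+ con ⅓ :* ((dk :- dj) :- (dk :- dj)) := dk :+ x) refl dk dj x ⟩
    dk + x ∎)
    where open ≡-Reasoning

  mixture-weights : ∀ μ ν → (1ℚ - (μ + ν)) + (μ + (ν + 0ℚ)) ≡ 1ℚ
  mixture-weights = solve 2 (λ μ ν → (con 1ℚ :- (μ :+ ν)) :+ (μ :+ (ν :+ con 0ℚ)) := con 1ℚ) refl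

  mixture-first : ∀ μ ν x x′ → (1ℚ - (μ + ν)) * x + (μ * x′ + (ν * x + 0ℚ)) ≡ x + μ * (x′ - x)
  mixture-first = solve 4 (λ μ ν x x′ → (con 1ℚ :- (μ :+ ν)) :* x :+ (μ :* x′ :+ (ν :* x :+ con 0ℚ))
                                        := x :+ μ :* (x′ :- x)) refl

  mixture-second : ∀ μ ν y y′ → (1ℚ - (μ + ν)) * y + (μ * y + (ν * y′ + 0ℚ)) ≡ y + ν * (y′ - y)
  mixture-second = solve 4 (λ μ ν y y′ → (con 1ℚ :- (μ :+ ν)) :* y :+ (μ :* y :+ (ν :* y′ :+ con 0ℚ))
                                         := y :+ ν :* (y′ :- y)) refl

  module _ {n} {k j : Fin n} (j≢k : j ≢ k) {a a′ b b′ : Fin n → ℚ}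
           (ab : PiPiGen n (a , b)) (a′b : PiPiGen n (a′ , b)) (ab′ : PiPiGen n (a , b′))
           (μ-step : HalfStep k j a a′) (ν-step : HalfStep k j b b′) where

    private
      open HalfStep
      μ = weight μ-step
      ν = weight ν-step

      mixture : List (ℚ × Pt n)
      mixture = (1ℚ - (μ + ν) , (a , b)) ∷ (μ , (a′ , b)) ∷ (ν , (a , b′)) ∷ []

      mixture∈PiPi : PiPi n (wsum mixture)
      mixture∈PiPi = mixture ,
        (x≤1⇒0≤1-x (+-≤-doubles {μ} {ν} (weight+weight≤1 μ-step) (weight+weight≤1 ν-step)) , ab) ∷
        (0≤weight μ-step , a′b) ∷ (0≤weight ν-step , ab′) ∷ [] ,
        mixture-weights μ ν ,
        ≈-refl

      mixture-coordinates : wsum mixture ≈ ((λ m → a m + μ * (a′ m - a m)) , (λ m → b m + ν * (b′ m - b m)))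
      mixture-coordinates =
        (λ m → mixture-first μ ν (a m) (a′ m)) , (λ m → mixture-second μ ν (b m) (b′ m))

    halfSteps⇒not-vertex : ¬ IsVertex (H n) (ef k ⊕ (a , b))
    halfSteps⇒not-vertex (_ , extremal) = ℚ.1≢0 (∙-cancelʳ (a j) 1ℚ 0ℚ at-j)
      where
      x y : Pt n
      x = ef j ⊕ (a , b)
      y = ef k ⊕ wsum mixture
      H-x : H n x
      H-x = ef j , (a , b) , conv-singleton (j , ≈-refl) , conv-singleton ab , ≈-refl
      H-y : H n y
      H-y = ef k , wsum mixture , conv-singleton (k , ≈-refl) , mixture∈PiPi , ≈-refl
      split : (ef k ⊕ (a , b)) ≈ ((⅓ · x) ⊕ ((1ℚ - ⅓) · y))
      split =
        (λ m → trans (trisect (δ k m) (δ j m) (a m) _ (step μ-step m))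
                     (cong (λ z → ⅓ * (δ j m + a m) + (1ℚ - ⅓) * (δ k m + z)) (sym (proj₁ mixture-coordinates m)))) ,
        (λ m → trans (trisect (δ k m) (δ j m) (b m) _ (step ν-step m))
                     (cong (λ z → ⅓ * (δ j m + b m) + (1ℚ - ⅓) * (δ k m + z)) (sym (proj₂ mixture-coordinates m))))
      x≈v : x ≈ (ef k ⊕ (a , b))
      x≈v = proj₁ (extremal x y ⅓ H-x H-y (toWitness {a? = 0ℚ ℚ.<? ⅓} _) (toWitness {a? = ⅓ ℚ.<? 1ℚ} _) split)
      at-j : 1ℚ + a j ≡ 0ℚ + a j
      at-j = trans (cong (_+ a j) (sym (δ-diag j))) (trans (proj₁ x≈v j) (cong (_+ a j) (δ-off (j≢k ∘ sym))))

  later-in-both⇒not-vertex : ∀ {n} {k j : Fin n} (σ ρ : Permutation′ n) → j ≢ k →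
    toℕ (σ ⟨$⟩ʳ k) ℕ.< toℕ (σ ⟨$⟩ʳ j) → toℕ (ρ ⟨$⟩ʳ k) ℕ.< toℕ (ρ ⟨$⟩ʳ j) →
    ¬ IsVertex (H n) (ef k ⊕ (oneLine σ , oneLine ρ))
  later-in-both⇒not-vertex {n} {k} {j} σ ρ j≢k σk<σj ρk<ρj =
    halfSteps⇒not-vertex j≢k {oneLine σ} {oneLine (transpose k j ∘ₚ σ)} {oneLine ρ} {oneLine (transpose k j ∘ₚ ρ)}
      ((σ , λ _ → refl) , (ρ , λ _ → refl)) ((transpose k j ∘ₚ σ , λ _ → refl) , (ρ , λ _ → refl))
      ((σ , λ _ → refl) , (transpose k j ∘ₚ ρ , λ _ → refl))
      (TranspositionStep.halfStep k j j≢k σ σk<σj) (TranspositionStep.halfStep k j j≢k ρ ρk<ρj)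

  vertex-decomposition : ∀ {n v} → IsVertex (H n) v → GeneratorSum n v
  vertex-decomposition {n} vertex@((d , p , Dd , Pp , v≈d⊕p) , _)
    with vertex-of-translated-hull {S = DGen n} {t = p} vertex (λ z hz → z , p , hz , Pp , ⊕-comm p z) Dd
                                   (≈-trans v≈d⊕p (⊕-comm d p))
  ... | s , (k , s≈eₖ) , v≈p⊕s
    with vertex-of-translated-hull {S = PiPiGen n} {t = s} vertex
                                   (λ z hz → s , z , conv-singleton (k , s≈eₖ) , hz , ≈-refl) Pp
                                   (≈-trans v≈p⊕s (⊕-comm p s))
  ... | q , ((σ , q₁≡) , (ρ , q₂≡)) , v≈s⊕q = k , σ , ρ , ≈-trans v≈s⊕q (⊕-cong s≈eₖ (q₁≡ , q₂≡))

  vertex⇒fine : ∀ {n v} → IsVertex (H n) v → FineTripleAt n v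
  vertex⇒fine {n} {v} vertex = fine-triple (vertex-decomposition vertex)
    where
    fine-triple : GeneratorSum n v → FineTripleAt n v
    -- invVec (flip σ) and pos (flip σ) are oneLine σ and toℕ ∘ (σ ⟨$⟩ʳ_) by definition.
    fine-triple (k , σ , ρ , v≈) =
      k , P.flip σ , P.flip ρ ,
      (λ j j≢k → (λ σk<σj → earlier ρ j≢k (λ ρk<ρj → not-vertex j≢k σk<σj ρk<ρj)) ,
                 (λ ρk<ρj → earlier σ j≢k (λ σk<σj → not-vertex j≢k σk<σj ρk<ρj))) ,
      v≈
      where
      not-vertex : ∀ {j} → j ≢ k →
                   toℕ (σ ⟨$⟩ʳ k) ℕ.< toℕ (σ ⟨$⟩ʳ j) → toℕ (ρ ⟨$⟩ʳ k) ℕ.< toℕ (ρ ⟨$⟩ʳ j) → ⊥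
      not-vertex j≢k σk<σj ρk<ρj = later-in-both⇒not-vertex σ ρ j≢k σk<σj ρk<ρj (H-vertex-resp-≈ v≈ vertex)
      earlier : ∀ π {j} → j ≢ k →
                ¬ (toℕ (π ⟨$⟩ʳ k) ℕ.< toℕ (π ⟨$⟩ʳ j)) → toℕ (π ⟨$⟩ʳ j) ℕ.< toℕ (π ⟨$⟩ʳ k)
      earlier π j≢k πk≮πj = ℕ.≤∧≢⇒< (ℕ.≮⇒≥ πk≮πj) (j≢k ∘ pos-injective (P.flip π))

open import Data.Nat using (ℕ; _≤_)
open import Data.Fin using (Fin)
open import Data.Fin.Permutation using (Permutation′)
open import Data.Product using (_×_; Σ; _,_)
open import Function.Bundles using (_⇔_; mk⇔)
open Points using (≈-sym)
open HarmonicPolytope using (H-vertex-resp-≈)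
open FineTriplesAreVertices using (fine⇒vertex)
open VerticesAreFine using (vertex⇒fine)

proposition2p6 : (n : ℕ) → 1 ≤ n → (v : Pt n) →
    IsVertex (H n) v ⇔ Σ (Fin n) (λ k → Σ (Permutation′ n) (λ π₁ → Σ (Permutation′ n) (λ π₂ → FineHarmonic n k π₁ π₂ × (v ≈ vτ k π₁ π₂))))
proposition2p6 n _ v = mk⇔ vertex⇒fine
  (λ (k , π₁ , π₂ , fine , v≈vτ) → H-vertex-resp-≈ (≈-sym v≈vτ) (fine⇒vertex {π₁ = π₁} {π₂} fine))
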